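{- For each $T \in \mathcal{T}(\mathcal{E},X)$, there is a deterministic tree $T' \in \mathcal{T}(\mathcal{E}, X)$ such that $\mathsf{yd}(T|_{\ell,\mathbf{1}})^\infty \le \mathsf{yd}(T')^\infty$.
   Context: $K$ is an absorptive ($1+a=1$), fully-continuous commutative semiring (natural order $a\le b$ iff $a+b=b$ is a complete lattice; $+,\cdot$ with a fixed element commute with suprema and infima of nonempty chains); $a^\infty:=\inf_{n\in\mathbb{N}}a^n$ (infimum w.r.t. the natural order). $\mathcal{E}\colon(X=P_X)_{X\in\mathbf{X}}$ is a polynomial equation system over $K$ with $\ell=|\mathbf{X}|$ indeterminates. A derivation tree is a possibly infinite rooted tree with node labelings $\mathsf{var}\colon V\to\mathbf{X}$ and $\mathsf{yd}\colon V\to K$; $\mathsf{mon}(v)$ is the product of the $\mathsf{var}$-labels of the children of $v$; $\mathcal{T}(\mathcal{E},X)$ is the set of trees with root labelled $X$ such that $\mathsf{yd}(v)\cdot\mathsf{mon}(v)$ is a coefficient–monomial term of $P_{\mathsf{var}(v)}$ for every node $v$. $\mathsf{yd}(T)=\prod_{v}\mathsf{yd}(v)$. $T$ is deterministic if $\mathsf{mon}(v)$ depends only on $\mathsf{var}(v)$. The truncation $T|_{\ell,\mathbf 1}$ is $T$ restricted to nodes of depth $\le\ell$, where nodes at depth exactly $\ell$ get yield $1$ and other nodes keep their yield. -}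

module Defs where

open import Level using (Level; _⊔_; suc; Lift)
open import Data.Nat using (ℕ; zero; _<ᵇ_) renaming (suc to sucℕ)
open import Data.Bool using (if_then_else_)
open import Data.Fin using (Fin; toℕ)
open import Data.Product using (Σ; ∃; _×_; _,_; proj₁; proj₂)
open import Data.List using (List; []; _∷_; map; length; foldr; tabulate)
open import Data.List.Relation.Unary.Any using (Any)
open import Data.List.Relation.Binary.Permutation.Propositional using (_↭_)
open import Relation.Binary.PropositionalEquality using (_≡_)
open import Relation.Unary using (Pred)
open import Data.Sum using (_⊎_)
open import Algebra.Bundles using (CommutativeSemiring)

module NaturalOrder {c ℓ : Level} (R : CommutativeSemiring c ℓ) where
  open CommutativeSemiring R

  _≤_ : Carrier → Carrier → Set ℓ
  a ≤ b = (a + b) ≈ b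

  IsLowerBound IsUpperBound : Pred Carrier (c ⊔ ℓ) → Carrier → Set (c ⊔ ℓ)
  IsLowerBound S x = ∀ y → S y → x ≤ y
  IsUpperBound S x = ∀ y → S y → y ≤ x

  IsChain : Pred Carrier (c ⊔ ℓ) → Set (c ⊔ ℓ)
  IsChain S = ∀ x y → S x → S y → (x ≤ y) ⊎ (y ≤ x)

  NonEmpty : Pred Carrier (c ⊔ ℓ) → Set (c ⊔ ℓ)
  NonEmpty S = ∃ λ x → S x

  image : (Carrier → Carrier) → Pred Carrier (c ⊔ ℓ) → Pred Carrier (c ⊔ ℓ)
  image f S y = ∃ λ x → S x × (y ≈ f x)

record IsAbsorptiveFC {c ℓ : Level} (R : CommutativeSemiring c ℓ) : Set (suc (c ⊔ ℓ)) where
  open CommutativeSemiring R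
  open NaturalOrder R
  field
    absorptive : ∀ a → (1# + a) ≈ 1#
    ⨆ ⨅ : Pred Carrier (c ⊔ ℓ) → Carrier
    ⨆-upper : ∀ S → IsUpperBound S (⨆ S)
    ⨆-least : ∀ S x → IsUpperBound S x → ⨆ S ≤ x
    ⨅-lower : ∀ S → IsLowerBound S (⨅ S)
    ⨅-greatest : ∀ S x → IsLowerBound S x → x ≤ ⨅ S
    +-⨆ : ∀ a S → NonEmpty S → IsChain S → (a + ⨆ S) ≈ ⨆ (image (a +_) S)
    *-⨆ : ∀ a S → NonEmpty S → IsChain S → (a * ⨆ S) ≈ ⨆ (image (a *_) S)
    +-⨅ : ∀ a S → NonEmpty S → IsChain S → (a + ⨅ S) ≈ ⨅ (image (a +_) S)
    *-⨅ : ∀ a S → NonEmpty S → IsChain S → (a * ⨅ S) ≈ ⨅ (image (a *_) S)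


record AbsorptiveFCSemiring (c ℓ : Level) : Set (suc (c ⊔ ℓ)) where
  field
    commutativeSemiring : CommutativeSemiring c ℓ
    isAbsorptiveFC      : IsAbsorptiveFC commutativeSemiring
  open CommutativeSemiring commutativeSemiring public
  open NaturalOrder commutativeSemiring public
  open IsAbsorptiveFC isAbsorptiveFC public

  infₙ : (ℕ → Carrier) → Carrier
  infₙ f = ⨅ (λ x → Lift c (∃ λ n → x ≈ f n))

  _^_ : Carrier → ℕ → Carrier
  a ^ zero = 1#
  a ^ sucℕ n = a * (a ^ n)

  _^∞ : Carrier → Carrier
  a ^∞ = infₙ (λ n → a ^ n)

  prod : List Carrier → Carrier
  prod = foldr _*_ 1#

module _ {c ℓ : Level} (K : AbsorptiveFCSemiring c ℓ) where
  open AbsorptiveFCSemiring K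

  -- A polynomial over K in indeterminates Fin n: a finite sum of terms
  -- c · m, each given by a coefficient and a monomial (a list of
  -- indeterminates, read as a commutative product, i.e. up to permutation).
  Polynomial : ℕ → Set c
  Polynomial n = List (Carrier × List (Fin n))

  System : ℕ → Set c
  System n = Fin n → Polynomial n

  -- Possibly infinite rooted, finitely branching, node-labelled trees,
  -- encoded by their labellings of addresses (paths from the root, given
  -- as lists of child indices). The nodes are the addresses
  -- i₁ ∷ … ∷ iₖ ∷ [] with each iⱼ below the arity of the preceding node.
  record Tree (n : ℕ) : Set c where
    field
      varAt   : List ℕ → Fin n
      ydAt    : List ℕ → Carrier
      arityAt : List ℕ → ℕ
  open Tree public

  var : ∀ {n} → Tree n → Fin n
  var t = varAt t []

  yd : ∀ {n} → Tree n → Carrier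
  yd t = ydAt t []

  sub : ∀ {n} → Tree n → ℕ → Tree n
  varAt   (sub t i) w = varAt t (i ∷ w)
  ydAt    (sub t i) w = ydAt t (i ∷ w)
  arityAt (sub t i) w = arityAt t (i ∷ w)

  children : ∀ {n} → Tree n → List (Tree n)
  children t = tabulate (λ (i : Fin (arityAt t [])) → sub t (toℕ i))

  mon : ∀ {n} → Tree n → List (Fin n)
  mon t = map var (children t)

  data Node {n : ℕ} : Tree n → Set c where
    root : ∀ {t} → Node t
    down : ∀ {t} (i : Fin (arityAt t [])) → Node (sub t (toℕ i)) → Node t

  at : ∀ {n} {t : Tree n} → Node t → Tree n
  at {t = t} root = t
  at (down i v) = at v

  LocallyValid : ∀ {n} → System n → Tree n → Set (c ⊔ ℓ)
  LocallyValid E t =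
    Any (λ term → (proj₁ term ≈ yd t) × (proj₂ term ↭ mon t)) (E (var t))

  _∈𝒯[_,_] : ∀ {n} → Tree n → System n → Fin n → Set (c ⊔ ℓ)
  T ∈𝒯[ E , X ] = (var T ≡ X) × (∀ (v : Node T) → LocallyValid E (at v))

  Deterministic : ∀ {n} → Tree n → Set c
  Deterministic T = ∀ (v w : Node T) → var (at v) ≡ var (at w) → mon (at v) ↭ mon (at w)

  ydBelow : ∀ {n} → ℕ → Tree n → Carrier
  ydBelow zero t = 1#
  ydBelow (sucℕ k) t = yd t * prod (map (ydBelow k) (children t))

  -- yd(T) = ∏_v yd(v), the (possibly infinite) product, taken as the
  -- infimum of the finite partial products over depth-truncations
  ydT : ∀ {n} → Tree n → Carrier
  ydT t = infₙ (λ k → ydBelow k t)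

  truncate : ∀ {n} → ℕ → Tree n → Tree n
  varAt   (truncate k t) w = varAt t w
  ydAt    (truncate k t) w = if length w <ᵇ k then ydAt t w else 1#
  arityAt (truncate k t) w = if length w <ᵇ k then arityAt t w else 0

{-# OPTIONS --safe #-}
-- Let z = yd(T|ℓ,1)^∞. The powers of an element form a chain, so by continuity z ≤ z·z; and z lies
-- below the yield of every node of T of depth < ℓ. Starting from the root, collect nodes of T with
-- pairwise distinct variables until the variables of the children of each collected node are
-- collected as well; as there are only ℓ variables, every collected node has depth < ℓ. Expanding
-- each collected variable by the rule used at its node gives a deterministic derivation tree T′ all
-- of whose node yields are ≥ z, and since z ≤ z·z it bounds every finite partial product, hence
-- yd(T′) and yd(T′)^∞.
module Submission where

open import Defs
open import Level using (Level; Lift; lift)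
open import Function using (_∘_)
open import Data.Nat as ℕ using (ℕ; zero; suc; z≤n; s≤s)
import Data.Nat.Properties as ℕ
open import Data.Fin as Fin using (Fin; zero; suc; toℕ)
open import Data.Fin.Properties using (any?; all?; ¬∀⟶∃¬; injective⇒≤)
open import Data.Product using (∃; Σ; _×_; _,_; proj₁; proj₂)
open import Data.Sum using (inj₁; inj₂)
open import Data.List using (List; []; _∷_; map)
open import Data.List.Properties using (map-tabulate)
open import Data.List.Relation.Unary.All using (All; []; _∷_)
open import Data.List.Relation.Unary.All.Properties using (tabulate⁺; map⁺)
open import Data.List.Relation.Unary.Any as Any using (here; there)
open import Data.List.Membership.Propositional using (_∈_)
open import Data.List.Membership.Propositional.Properties using (∈-map⁺; ∈-tabulate⁺)
open import Data.List.Relation.Binary.Permutation.Propositional using (_↭_; ↭-reflexive; ↭-trans)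
open import Relation.Nullary using (¬_; yes; no; Dec; contradiction)
open import Data.Empty using (⊥-elim)
open import Relation.Binary.PropositionalEquality as ≡ using (_≡_; refl; cong; subst)

module NaturalOrderProperties {c ℓ} (K : AbsorptiveFCSemiring c ℓ) where
  open AbsorptiveFCSemiring K renaming (refl to ≈-refl)
  open import Relation.Binary.Reasoning.Setoid setoid

  +-idem : ∀ a → (a + a) ≈ a
  +-idem a = begin
    a + a             ≈⟨ +-cong (sym (*-identityʳ a)) (sym (*-identityʳ a)) ⟩
    a * 1# + a * 1#   ≈⟨ sym (distribˡ a 1# 1#) ⟩
    a * (1# + 1#)     ≈⟨ *-congˡ (absorptive 1#) ⟩
    a * 1#            ≈⟨ *-identityʳ a ⟩
    a                 ∎

  ≤-reflexive : ∀ {a b} → a ≈ b → a ≤ b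
  ≤-reflexive {a} {b} a≈b = trans (+-congʳ a≈b) (+-idem b)

  ≤-trans : ∀ {a b d} → a ≤ b → b ≤ d → a ≤ d
  ≤-trans {a} {b} {d} a≤b b≤d = begin
    a + d         ≈⟨ +-congˡ (sym b≤d) ⟩
    a + (b + d)   ≈⟨ sym (+-assoc a b d) ⟩
    (a + b) + d   ≈⟨ +-congʳ a≤b ⟩
    b + d         ≈⟨ b≤d ⟩
    d             ∎

  x≤1 : ∀ a → a ≤ 1#
  x≤1 a = trans (+-comm a 1#) (absorptive a)

  *-monoʳ-≤ : ∀ d {a b} → a ≤ b → (a * d) ≤ (b * d)
  *-monoʳ-≤ d {a} {b} a≤b = trans (sym (distribʳ d a b)) (*-congʳ a≤b)

  *-monoˡ-≤ : ∀ d {a b} → a ≤ b → (d * a) ≤ (d * b)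
  *-monoˡ-≤ d {a} {b} a≤b = begin
    d * a + d * b   ≈⟨ sym (distribˡ d a b) ⟩
    d * (a + b)     ≈⟨ *-congˡ a≤b ⟩
    d * b           ∎

  x*y≤x : ∀ a b → (a * b) ≤ a
  x*y≤x a b = ≤-trans (*-monoˡ-≤ a (x≤1 b)) (≤-reflexive (*-identityʳ a))

  x*y≤y : ∀ a b → (a * b) ≤ b
  x*y≤y a b = ≤-trans (≤-reflexive (*-comm a b)) (x*y≤x b a)

  ≤-* : ∀ {z a b} → z ≤ (z * z) → z ≤ a → z ≤ b → z ≤ (a * b)
  ≤-* {z} z≤z² z≤a z≤b = ≤-trans z≤z² (≤-trans (*-monoʳ-≤ z z≤a) (*-monoˡ-≤ _ z≤b))

  prod-≤ : ∀ {a xs} → a ∈ xs → prod xs ≤ a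
  prod-≤ (here refl) = x*y≤x _ _
  prod-≤ (there a∈xs) = ≤-trans (x*y≤y _ _) (prod-≤ a∈xs)

  ≤-prod : ∀ {z xs} → z ≤ (z * z) → All (z ≤_) xs → z ≤ prod xs
  ≤-prod z≤z² [] = x≤1 _
  ≤-prod z≤z² (z≤x ∷ z≤xs) = ≤-* z≤z² z≤x (≤-prod z≤z² z≤xs)

  infₙ-≤ : ∀ (f : ℕ → Carrier) k → infₙ f ≤ f k
  infₙ-≤ f k = ⨅-lower _ (f k) (lift (k , ≈-refl))

  ≤-infₙ : ∀ {z} (f : ℕ → Carrier) → (∀ k → z ≤ f k) → z ≤ infₙ f
  ≤-infₙ {z} f z≤f = ⨅-greatest _ z λ { y (lift (k , y≈fk)) → ≤-trans (z≤f k) (≤-reflexive (sym y≈fk)) }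

  ^-distribˡ-+-* : ∀ a j k → (a ^ (j ℕ.+ k)) ≈ ((a ^ j) * (a ^ k))
  ^-distribˡ-+-* a zero k = sym (*-identityˡ _)
  ^-distribˡ-+-* a (suc j) k = trans (*-congˡ (^-distribˡ-+-* a j k)) (sym (*-assoc _ _ _))

  ^-antitone : ∀ a {j k} → j ℕ.≤ k → (a ^ k) ≤ (a ^ j)
  ^-antitone a z≤n = x≤1 _
  ^-antitone a (s≤s j≤k) = *-monoˡ-≤ a (^-antitone a j≤k)

  ^∞-≤-^ : ∀ a k → (a ^∞) ≤ (a ^ k)
  ^∞-≤-^ a = infₙ-≤ (a ^_)

  ^∞-≤ : ∀ a → (a ^∞) ≤ a
  ^∞-≤ a = ≤-trans (^∞-≤-^ a 1) (≤-reflexive (*-identityʳ a))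

  -- The powers of a form a chain, so multiplication by d commutes with their infimum.
  ≤-*^∞ : ∀ {z} a d → (∀ k → z ≤ (d * (a ^ k))) → z ≤ (d * (a ^∞))
  ≤-*^∞ {z} a d z≤d*aᵏ =
    ≤-trans (⨅-greatest _ z bound) (≤-reflexive (sym (*-⨅ d powers (1# , lift (0 , ≈-refl)) chain)))
    where
    powers = λ x → Lift c (∃ λ k → x ≈ (a ^ k))

    chain : IsChain powers
    chain x y (lift (j , x≈aʲ)) (lift (k , y≈aᵏ)) with ℕ.≤-total j k
    ... | inj₁ j≤k = inj₂ (≤-trans (≤-reflexive y≈aᵏ) (≤-trans (^-antitone a j≤k) (≤-reflexive (sym x≈aʲ))))
    ... | inj₂ k≤j = inj₁ (≤-trans (≤-reflexive x≈aʲ) (≤-trans (^-antitone a k≤j) (≤-reflexive (sym y≈aᵏ))))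

    bound : IsLowerBound (image (d *_) powers) z
    bound y (x , lift (k , x≈aᵏ) , y≈d*x) =
      ≤-trans (z≤d*aᵏ k) (≤-reflexive (sym (trans y≈d*x (*-congˡ x≈aᵏ))))

  ^∞-≤-^*^∞ : ∀ a j → (a ^∞) ≤ ((a ^ j) * (a ^∞))
  ^∞-≤-^*^∞ a j = ≤-*^∞ a (a ^ j) λ k →
    ≤-trans (^∞-≤-^ a (j ℕ.+ k)) (≤-reflexive (^-distribˡ-+-* a j k))

  ^∞-≤-^∞*^∞ : ∀ a → (a ^∞) ≤ ((a ^∞) * (a ^∞))
  ^∞-≤-^∞*^∞ a = ≤-*^∞ a (a ^∞) λ k →
    ≤-trans (^∞-≤-^*^∞ a k) (≤-reflexive (*-comm _ _))

  ≤-^∞ : ∀ {z y} → z ≤ (z * z) → z ≤ y → z ≤ (y ^∞)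
  ≤-^∞ {z} {y} z≤z² z≤y = ≤-infₙ (y ^_) ≤-^
    where
    ≤-^ : ∀ k → z ≤ (y ^ k)
    ≤-^ zero = x≤1 z
    ≤-^ (suc k) = ≤-* z≤z² z≤y (≤-^ k)

module _ {c ℓ} (K : AbsorptiveFCSemiring c ℓ) {n : ℕ} where
  open AbsorptiveFCSemiring K using (Carrier; _≈_; _≤_; _*_; prod; trans)
  open NaturalOrderProperties K

  depth : {t : Tree K n} → Node K t → ℕ
  depth root = 0
  depth (down i v) = suc (depth v)

  label : {t : Tree K n} → Node K t → Fin n
  label v = var K (at K v)

  extend : {t : Tree K n} (v : Node K t) → Fin (arityAt (at K v) []) → Node K t
  extend root j = down j root
  extend (down i v) j = down i (extend v j)

  at-extend : {t : Tree K n} (v : Node K t) (j : Fin (arityAt (at K v) [])) →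
              at K (extend v j) ≡ sub K (at K v) (toℕ j)
  at-extend root j = refl
  at-extend (down i v) j = at-extend v j

  depth-extend : {t : Tree K n} (v : Node K t) (j : Fin (arityAt (at K v) [])) →
                 depth (extend v j) ≡ suc (depth v)
  depth-extend root j = refl
  depth-extend (down i v) j = cong suc (depth-extend v j)

  prod-children-≤ : ∀ (h : Tree K n → Carrier) (t : Tree K n) i →
                    prod (map h (children K t)) ≤ h (sub K t (toℕ i))
  prod-children-≤ h t i = prod-≤ (∈-map⁺ h (∈-tabulate⁺ {f = λ (j : Fin (arityAt t [])) → sub K t (toℕ j)} i))

  ≤-prod-children : ∀ {z} (h : Tree K n → Carrier) (t : Tree K n) →
                    z ≤ (z * z) → (∀ i → z ≤ h (sub K t (toℕ i))) → z ≤ prod (map h (children K t))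
  ≤-prod-children h t z≤z² z≤h = ≤-prod z≤z² (map⁺ (tabulate⁺ {f = λ (j : Fin (arityAt t [])) → sub K t (toℕ j)} z≤h))

  -- A subtree of truncate (suc k) t is definitionally truncate k of the subtree.
  ydBelow-truncate-≤-yd : ∀ k (t : Tree K n) (v : Node K t) → depth v ℕ.< k →
                          ydBelow K k (truncate K k t) ≤ yd K (at K v)
  ydBelow-truncate-≤-yd (suc k) t root _ = x*y≤x _ _
  ydBelow-truncate-≤-yd (suc k) t (down i v) (s≤s depth<k) =
    ≤-trans (x*y≤y _ _)
      (≤-trans (prod-children-≤ (ydBelow K k) (truncate K (suc k) t) i)
               (ydBelow-truncate-≤-yd k (sub K t (toℕ i)) v depth<k))

  ydT-truncate-≤-yd : ∀ k (t : Tree K n) (v : Node K t) → depth v ℕ.< k →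
                      ydT K (truncate K k t) ≤ yd K (at K v)
  ydT-truncate-≤-yd k t v depth<k = ≤-trans (infₙ-≤ _ k) (ydBelow-truncate-≤-yd k t v depth<k)

  locallyValid-transport : ∀ (E : System K n) {s t : Tree K n} →
    var K s ≡ var K t → yd K s ≈ yd K t → mon K s ↭ mon K t → LocallyValid K E s → LocallyValid K E t
  locallyValid-transport E {s} var≡ yd≈ mon↭ valid with var K s | var≡ | valid
  ... | _ | refl | valid′ =
    Any.map (λ (coeff≈ , monomial↭) → trans coeff≈ yd≈ , ↭-trans monomial↭ mon↭) valid′

-- R Y supplies, through its root, the rule used at every occurrence of Y.
module RuleTree {c ℓ} (K : AbsorptiveFCSemiring c ℓ) {n : ℕ} (R : Fin n → Tree K n) where
  open AbsorptiveFCSemiring K using (_≤_; _*_) renaming (refl to ≈-refl)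
  open NaturalOrderProperties K

  child : Fin n → ℕ → Fin n
  child Y i = var K (sub K (R Y) i)

  walk : Fin n → List ℕ → Fin n
  walk Y [] = Y
  walk Y (i ∷ w) = walk (child Y i) w

  ruleTree : Fin n → Tree K n
  varAt (ruleTree Y) w = walk Y w
  ydAt (ruleTree Y) w = yd K (R (walk Y w))
  arityAt (ruleTree Y) w = arityAt (R (walk Y w)) []

  mon-ruleTree : ∀ Y → mon K (ruleTree Y) ≡ mon K (R Y)
  mon-ruleTree Y = ≡.trans (map-tabulate (λ i → sub K (ruleTree Y) (toℕ i)) (var K))
                           (≡.sym (map-tabulate (λ i → sub K (R Y) (toℕ i)) (var K)))

  at-ruleTree : ∀ Y (v : Node K (ruleTree Y)) → at K v ≡ ruleTree (label K v)
  at-ruleTree Y root = refl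
  at-ruleTree Y (down i v) = at-ruleTree (child Y (toℕ i)) v

  ruleTree-deterministic : ∀ Y → Deterministic K (ruleTree Y)
  ruleTree-deterministic Y v w same-label = ↭-reflexive (cong (mon K) (begin
    at K v                 ≡⟨ at-ruleTree Y v ⟩
    ruleTree (label K v)   ≡⟨ cong ruleTree same-label ⟩
    ruleTree (label K w)   ≡⟨ at-ruleTree Y w ⟨
    at K w                 ∎))
    where open ≡.≡-Reasoning

  module _ {p} (C : Fin n → Set p)
           (child-closed : ∀ {Y} → C Y → (i : Fin (arityAt (R Y) [])) → C (child Y (toℕ i))) where

    label-closed : ∀ Y → C Y → (v : Node K (ruleTree Y)) → C (label K v)
    label-closed Y cY root = cY
    label-closed Y cY (down i v) = label-closed (child Y (toℕ i)) (child-closed cY i) v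

    ruleTree-∈𝒯 : ∀ E → (∀ Y → C Y → var K (R Y) ≡ Y × LocallyValid K E (R Y)) →
                  ∀ Y → C Y → _∈𝒯[_,_] K (ruleTree Y) E Y
    ruleTree-∈𝒯 E rules-valid Y cY = refl , λ v →
      subst (LocallyValid K E) (≡.sym (at-ruleTree Y v)) (ruleTree-locallyValid (label-closed Y cY v))
      where
      ruleTree-locallyValid : ∀ {Z} → C Z → LocallyValid K E (ruleTree Z)
      ruleTree-locallyValid {Z} cZ with rules-valid Z cZ
      ... | var≡Z , valid = locallyValid-transport K E {R Z} {ruleTree Z}
                              var≡Z ≈-refl (↭-reflexive (≡.sym (mon-ruleTree Z))) valid

  ≤-ydT-ruleTree : ∀ {z} → z ≤ (z * z) → (∀ Y → z ≤ yd K (R Y)) → ∀ Y → z ≤ ydT K (ruleTree Y)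
  ≤-ydT-ruleTree {z} z≤z² z≤yd Y = ≤-infₙ _ λ k → ≤-ydBelow k Y
    where
    ≤-ydBelow : ∀ k Y → z ≤ ydBelow K k (ruleTree Y)
    ≤-ydBelow zero Y = x≤1 z
    ≤-ydBelow (suc k) Y = ≤-* z≤z² (z≤yd Y)
      (≤-prod-children K (ydBelow K k) (ruleTree Y) z≤z² λ i → ≤-ydBelow k (child Y (toℕ i)))

module _ {c ℓ} (K : AbsorptiveFCSemiring c ℓ) {n : ℕ} (T : Tree K n) where

  record Representatives : Set c where
    field
      size             : ℕ
      node             : Fin size → Node K T
      label-injective  : ∀ {i j} → label K (node i) ≡ label K (node j) → i ≡ j
      shallow          : ∀ i → depth K (node i) ℕ.< size
      root-represented : ∃ λ i → label K (node i) ≡ var K T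
  open Representatives

  Represents : Representatives → Fin n → Set
  Represents r Y = ∃ λ i → label K (node r i) ≡ Y

  represents? : ∀ r Y → Dec (Represents r Y)
  represents? r Y = any? λ i → label K (node r i) Fin.≟ Y

  childLabel : ∀ r (i : Fin (size r)) → Fin (arityAt (at K (node r i)) []) → Fin n
  childLabel r i j = var K (sub K (at K (node r i)) (toℕ j))

  ChildClosed : Representatives → Set
  ChildClosed r = ∀ i j → Represents r (childLabel r i j)

  size≤n : ∀ r → size r ℕ.≤ n
  size≤n r = injective⇒≤ (label-injective r)

  rootOnly : Representatives
  size rootOnly = 1
  node rootOnly _ = root
  label-injective rootOnly {zero} {zero} _ = refl
  shallow rootOnly _ = s≤s z≤n
  root-represented rootOnly = zero , refl

  addChild : ∀ r i j → ¬ Represents r (childLabel r i j) → Representatives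
  size (addChild r i j new) = suc (size r)
  node (addChild r i j new) zero = extend K (node r i) j
  node (addChild r i j new) (suc k) = node r k
  label-injective (addChild r i j new) {zero} {zero} _ = refl
  label-injective (addChild r i j new) {zero} {suc k} same =
    ⊥-elim (new (k , ≡.trans (≡.sym same) (cong (var K) (at-extend K (node r i) j))))
  label-injective (addChild r i j new) {suc k} {zero} same =
    ⊥-elim (new (k , ≡.trans same (cong (var K) (at-extend K (node r i) j))))
  label-injective (addChild r i j new) {suc k} {suc k′} same = cong suc (label-injective r same)
  shallow (addChild r i j new) zero rewrite depth-extend K (node r i) j = s≤s (shallow r i)
  shallow (addChild r i j new) (suc k) = ℕ.m≤n⇒m≤1+n (shallow r k)
  root-represented (addChild r i j new) = suc (proj₁ (root-represented r)) , proj₂ (root-represented r)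

  unrepresentedChild : ∀ r → ¬ ChildClosed r → ∃ λ i → ∃ λ j → ¬ Represents r (childLabel r i j)
  unrepresentedChild r ¬closed with ¬∀⟶∃¬ _ _ (λ i → all? λ j → represents? r (childLabel r i j)) ¬closed
  ... | i , ¬closedᵢ = i , ¬∀⟶∃¬ _ _ (λ j → represents? r (childLabel r i j)) ¬closedᵢ

  -- Each step adds a node with a fresh label, which can happen fewer than n times.
  close : ∀ fuel r → n ℕ.< size r ℕ.+ fuel → Σ Representatives ChildClosed
  close zero r n<size = contradiction (size≤n r) (ℕ.<⇒≱ (subst (n ℕ.<_) (ℕ.+-identityʳ (size r)) n<size))
  close (suc fuel) r n<size+fuel with all? (λ i → all? λ j → represents? r (childLabel r i j))
  ... | yes closed = r , closed
  ... | no ¬closed with unrepresentedChild r ¬closed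
  ... | i , j , new = close fuel (addChild r i j new) (subst (n ℕ.<_) (ℕ.+-suc (size r) fuel) n<size+fuel)

  closedRepresentatives : Σ Representatives ChildClosed
  closedRepresentatives = close n rootOnly (ℕ.n<1+n n)

  module _ (r : Representatives) where

    -- Unrepresented variables get the root as a junk representative.
    representative : Fin n → Node K T
    representative Y with represents? r Y
    ... | yes (i , _) = node r i
    ... | no _ = root

    representative-label : ∀ {Y} → Represents r Y → label K (representative Y) ≡ Y
    representative-label {Y} represented with represents? r Y
    ... | yes (i , labelᵢ≡Y) = labelᵢ≡Y
    ... | no unrepresented = contradiction represented unrepresented

    representative-shallow : ∀ Y → depth K (representative Y) ℕ.< n
    representative-shallow Y = ℕ.<-≤-trans (shallow-size Y) (size≤n r)
      where
      shallow-size : ∀ Y → depth K (representative Y) ℕ.< size r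
      shallow-size Y with represents? r Y | root-represented r
      ... | yes (i , _) | _ = shallow r i
      ... | no _ | (zero , _) = s≤s z≤n
      ... | no _ | (suc _ , _) = s≤s z≤n

    representative-childClosed : ChildClosed r → ∀ {Y} → Represents r Y →
      (j : Fin (arityAt (at K (representative Y)) [])) →
      Represents r (var K (sub K (at K (representative Y)) (toℕ j)))
    representative-childClosed closed {Y} represented with represents? r Y
    ... | yes (i , _) = closed i
    ... | no unrepresented = contradiction represented unrepresented

corollary24 : ∀ {c ℓ : Level} (K : AbsorptiveFCSemiring c ℓ) (n : ℕ)
                (E : System K n) (X : Fin n) (T : Tree K n) →
                _∈𝒯[_,_] K T E X →
                ∃ λ (T′ : Tree K n) → _∈𝒯[_,_] K T′ E X × Deterministic K T′ ×
                  AbsorptiveFCSemiring._≤_ K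
                    (AbsorptiveFCSemiring._^∞ K (ydT K (truncate K n T)))
                    (AbsorptiveFCSemiring._^∞ K (ydT K T′))
corollary24 K n E X T (refl , T-valid) =
  ruleTree X ,
  ruleTree-∈𝒯 (Represents K T reps) (representative-childClosed K T reps (proj₂ closedReps)) E
    (λ Y represented → representative-label K T reps represented , T-valid (representative K T reps Y))
    X (Representatives.root-represented reps) ,
  ruleTree-deterministic X ,
  ≤-^∞ z≤z² (≤-ydT-ruleTree z≤z² z≤yd X)
  where
  open AbsorptiveFCSemiring K using (Carrier; _≤_; _*_; _^∞)
  open NaturalOrderProperties K

  closedReps : Σ (Representatives K T) (ChildClosed K T)
  closedReps = closedRepresentatives K T

  reps : Representatives K T
  reps = proj₁ closedReps

  rule : Fin n → Tree K n
  rule Y = at K (representative K T reps Y)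

  open RuleTree K rule

  z : Carrier
  z = ydT K (truncate K n T) ^∞

  z≤z² : z ≤ (z * z)
  z≤z² = ^∞-≤-^∞*^∞ (ydT K (truncate K n T))

  z≤yd : ∀ Y → z ≤ yd K (rule Y)
  z≤yd Y = ≤-trans (^∞-≤ _)
    (ydT-truncate-≤-yd K n T (representative K T reps Y) (representative-shallow K T reps Y))
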